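{- For all natural numbers $n,d>1$ and every integer $r$ with $0\le r<d$, there exists a sentence $\theta$ of ${\cal R}ing(0,+,*)+MOD(d)$ such that $Sp(\theta)=^*\{p\text{ prime}: p\equiv rn+1 \pmod{nd}\}$.
   Context: For an integer $m\ge1$, $\mathbb{Z}_m$ is the finite residue class ring with universe $\{0,\ldots,m-1\}$ and addition and multiplication mod $m$. ${\cal R}ing(0,+,*)$ is the set of first-order formulas over a constant symbol $0$ and binary function symbols $+,*$, interpreted in $\mathbb{Z}_m$ as the residue class $0$ and addition and multiplication mod $m$. ${\cal R}ing(0,+,*)+MOD(d)$ extends it with modular quantifiers $\exists^{(r,d)}z$ ($0\le r<d$), where $\mathbb{Z}_m\models\exists^{(r,d)}z\,\phi(\bar a,z)$ iff the number of $z\in\mathbb{Z}_m$ satisfying $\phi(\bar a,z)$ is congruent to $r$ modulo $d$. The prime spectrum of a sentence $\sigma$ is $Sp(\sigma)=\{p\text{ prime}:\mathbb{Z}_p\models\sigma\}$. For sets $A,B$ of primes, $A=^*B$ means their symmetric difference is finite. -}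

module Defs where

open import Data.Nat using (ℕ; zero; suc; _+_; _*_; _%_; _≤_)
open import Data.Nat.Primality using (Prime)
open import Data.Fin using (Fin; toℕ)
open import Data.Bool using (Bool; true; false; not; _∧_; if_then_else_; T)
open import Data.List using (List; upTo; map)
open import Data.Nat.ListAction using (sum)
open import Data.Bool.ListAction using (any)
open import Data.Product using (_×_; ∃-syntax)
open import Relation.Nullary.Decidable using (⌊_⌋)
import Data.Nat as ℕ
import Data.Integer as ℤ
open import Data.Integer.Divisibility using (_∣_)

-- c mod m (for m ≥ 1); the case m = 0 never matters below
_mod_ : ℕ → ℕ → ℕ
c mod zero    = c
c mod (suc k) = c % suc k

-- Terms of Ring(0,+,*) with n free variables (de Bruijn indices)
data Term (n : ℕ) : Set where
  var   : Fin n → Term n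
  zer   : Term n
  _⊕_   : Term n → Term n → Term n
  _⊗_   : Term n → Term n → Term n

-- Formulas of Ring(0,+,*) + MOD(d) with n free variables.
-- ∃mod r φ is the modular quantifier ∃^(r,d), 0 ≤ r < d.
data Formula (d : ℕ) (n : ℕ) : Set where
  _≐_   : Term n → Term n → Formula d n
  ¬'_   : Formula d n → Formula d n
  _∧'_  : Formula d n → Formula d n → Formula d n
  ∃'_   : Formula d (suc n) → Formula d n
  ∃mod  : Fin d → Formula d (suc n) → Formula d n

Sentence : ℕ → Set
Sentence d = Formula d 0

extend : ∀ {n} → (Fin n → ℕ) → ℕ → Fin (suc n) → ℕ
extend ρ z Fin.zero    = z
extend ρ z (Fin.suc i) = ρ i

-- term evaluation in Z_m (elements represented by 0..m-1)
evalT : (m : ℕ) → ∀ {n} → Term n → (Fin n → ℕ) → ℕ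
evalT m (var i) ρ = ρ i
evalT m zer     ρ = 0
evalT m (t ⊕ u) ρ = (evalT m t ρ + evalT m u ρ) mod m
evalT m (t ⊗ u) ρ = (evalT m t ρ * evalT m u ρ) mod m

countTrue : ℕ → (ℕ → Bool) → ℕ
countTrue m f = sum (map (λ z → if f z then 1 else 0) (upTo m))

sat : (m : ℕ) → ∀ {d n} → Formula d n → (Fin n → ℕ) → Bool
sat m (t ≐ u)     ρ = ⌊ evalT m t ρ ℕ.≟ evalT m u ρ ⌋
sat m (¬' φ)      ρ = not (sat m φ ρ)
sat m (φ ∧' ψ)    ρ = sat m φ ρ ∧ sat m ψ ρ
sat m (∃' φ)      ρ = any (λ z → sat m φ (extend ρ z)) (upTo m)
sat m {d} (∃mod r φ) ρ =
  ⌊ (countTrue m (λ z → sat m φ (extend ρ z)) mod d) ℕ.≟ toℕ r ⌋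

noVars : Fin 0 → ℕ
noVars ()

_⊨_ : ∀ {d} → ℕ → Sentence d → Set
m ⊨ σ = T (sat m σ noVars)

Sp : ∀ {d} → Sentence d → ℕ → Set
Sp σ p = Prime p × (p ⊨ σ)

-- A =* B : symmetric difference finite (i.e. bounded, as subsets of ℕ)
_=*_ : (ℕ → Set) → (ℕ → Set) → Set
A =* B = ∃[ N ] (∀ p → N ≤ p → (A p → B p) × (B p → A p))

PrimesCong : ℕ → ℕ → ℕ → ℕ → Set
PrimesCong n d r p =
  Prime p × (ℤ.+ (n * d) ∣ (ℤ.+ p ℤ.- ℤ.+ (r * n + 1)))

-- In ℤ_p the sentence θ says: at least n elements satisfy x ^ n = 1, and the number of nonzero
-- n-th powers is ≡ r (mod d). A monic polynomial of degree k has at most k roots mod p, and by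
-- Fermat and Bézout every root of x ^ n = 1 is a root of x ^ gcd(n, p - 1) = 1; so the first
-- clause forces n ∣ p - 1. If p - 1 = n m, Fermat sends every nonzero n-th power to a root of
-- s ^ m = 1, of which there are at most m, and each fibre of x ↦ x ^ n has at most n elements.
-- The fibres partition ℤ_p, so all these bounds are attained: there are exactly n n-th roots of
-- unity and exactly m nonzero n-th powers. Hence ℤ_p ⊨ θ iff n ∣ p - 1 and (p - 1) / n ≡ r
-- (mod d), i.e. iff p ≡ r n + 1 (mod n d), for every prime p.

module Submission where

open import Defs
open import Data.Nat using (ℕ; suc; _<_; NonZero)
open import Data.Product using (∃-syntax)

open import Data.Nat.Primality using (Prime)
open import Data.Fin using (fromℕ<)
open import Data.Product using (_,_)
open import Function using (Equivalence)

module Counting where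

  open import Data.Nat
  open import Data.Nat.Properties
  open import Data.Bool using (Bool; true; false; not; _∧_; _∨_; if_then_else_; T)
  open import Data.Bool.Properties using (T-∧)
  open import Data.Fin using (toℕ)
  open import Data.Fin.Properties using (toℕ<n)
  open import Data.List using (upTo; applyUpTo)
  open import Data.List.Properties using (map-upTo)
  open import Data.List.Membership.Propositional using (find; lose)
  open import Data.List.Membership.Propositional.Properties using (∈-upTo⁺; ∈-upTo⁻)
  open import Data.List.Relation.Unary.Any.Properties using (any⁺; any⁻)
  open import Data.Bool.ListAction using (any)
  import Data.Nat.ListAction as List
  open import Data.Product using (_×_; _,_; proj₂; ∃-syntax)
  open import Data.Empty using (⊥; ⊥-elim)
  open import Function using (_∘_; _⇔_; mk⇔; Equivalence)
  open import Relation.Nullary using (yes; no)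
  open import Relation.Nullary.Decidable using (⌊_⌋; toWitness; fromWitness)
  open import Relation.Binary.PropositionalEquality
  open import Algebra.Properties.Monoid.Sum +-0-monoid using (sum; sum-cong-≗)
  open import Algebra.Properties.CommutativeMonoid.Sum +-0-commutativeMonoid using (∑-comm; ∑-distrib-+)
  open import Algebra.Properties.Semiring.Sum +-*-semiring using (*-distribʳ-sum)

  infix 6.5 _==_
  _==_ : ℕ → ℕ → Bool
  a == b = ⌊ a ≟ b ⌋

  ==-comm : ∀ a b → (a == b) ≡ (b == a)
  ==-comm a b with a ≟ b | b ≟ a
  ... | yes _ | yes _ = refl
  ... | no _  | no _  = refl
  ... | yes e | no ne = ⊥-elim (ne (sym e))
  ... | no ne | yes e = ⊥-elim (ne (sym e))

  not-==⇒≢ : ∀ {a b} → T (not (a == b)) → a ≢ b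
  not-==⇒≢ {a} {b} a≠b a≡b with a ≟ b
  ... | yes _   = a≠b
  ... | no a≢b = a≢b a≡b

  ≢⇒not-== : ∀ {a b} → a ≢ b → T (not (a == b))
  ≢⇒not-== {a} {b} a≢b with a ≟ b
  ... | yes a≡b = a≢b a≡b
  ... | no _    = _

  T-ext : ∀ {a b} → (T a → T b) → (T b → T a) → a ≡ b
  T-ext {false} {false} _ _ = refl
  T-ext {false} {true}  _ g = ⊥-elim (g _)
  T-ext {true}  {false} f _ = ⊥-elim (f _)
  T-ext {true}  {true}  _ _ = refl

  ∑< : ℕ → (ℕ → ℕ) → ℕ
  ∑< m f = sum {m} (λ i → f (toℕ i))

  ∑<-cong : ∀ m {f g : ℕ → ℕ} → (∀ i → i < m → f i ≡ g i) → ∑< m f ≡ ∑< m g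
  ∑<-cong m eq = sum-cong-≗ (λ i → eq (toℕ i) (toℕ<n i))

  ∑<-mono-≤ : ∀ m {f g : ℕ → ℕ} → (∀ i → i < m → f i ≤ g i) → ∑< m f ≤ ∑< m g
  ∑<-mono-≤ zero    _  = z≤n
  ∑<-mono-≤ (suc m) le = +-mono-≤ (le 0 z<s) (∑<-mono-≤ m (λ i i<m → le (suc i) (s<s i<m)))

  ∑<-const : ∀ m c → ∑< m (λ _ → c) ≡ m * c
  ∑<-const zero    c = refl
  ∑<-const (suc m) c = cong (c +_) (∑<-const m c)

  ∑<-distrib-+ : ∀ m (f g : ℕ → ℕ) → ∑< m (λ i → f i + g i) ≡ ∑< m f + ∑< m g
  ∑<-distrib-+ m f g = ∑-distrib-+ {m} (λ i → f (toℕ i)) (λ i → g (toℕ i))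

  ∑<-comm : ∀ m k (f : ℕ → ℕ → ℕ) → ∑< m (λ i → ∑< k (f i)) ≡ ∑< k (λ j → ∑< m (λ i → f i j))
  ∑<-comm m k f = ∑-comm {m} {k} (λ i j → f (toℕ i) (toℕ j))

  ∑<-*ʳ : ∀ m (f : ℕ → ℕ) c → ∑< m (λ i → f i * c) ≡ ∑< m f * c
  ∑<-*ʳ m f c = sym (*-distribʳ-sum {m} c (λ i → f (toℕ i)))

  +-mono-≤-≡ : ∀ {a b c d} → a ≤ b → c ≤ d → a + c ≡ b + d → a ≡ b × c ≡ d
  +-mono-≤-≡ {a} {b} {c} {d} a≤b c≤d eq = a≡b , +-cancelˡ-≡ a c d (trans eq (cong (_+ d) (sym a≡b)))
    where
    a≡b : a ≡ b
    a≡b = ≤-antisym a≤b (+-cancelʳ-≤ c b a (≤-trans (+-monoʳ-≤ b c≤d) (≤-reflexive (sym eq))))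

  ∑<-mono-≤-≡ : ∀ m {f g : ℕ → ℕ} → (∀ i → i < m → f i ≤ g i) → ∑< m f ≡ ∑< m g →
                ∀ i → i < m → f i ≡ g i
  ∑<-mono-≤-≡ (suc m) le eq i i<1+m
    with +-mono-≤-≡ (le 0 z<s) (∑<-mono-≤ m (λ j j<m → le (suc j) (s<s j<m))) eq
  ∑<-mono-≤-≡ (suc m) le eq zero    _         | f0≡g0 , _ = f0≡g0
  ∑<-mono-≤-≡ (suc m) le eq (suc i) (s<s i<m) | _ , rest  =
    ∑<-mono-≤-≡ m (λ j j<m → le (suc j) (s<s j<m)) rest i i<m

  𝟙 : Bool → ℕ
  𝟙 b = if b then 1 else 0

  count : ℕ → (ℕ → Bool) → ℕ
  count m P = ∑< m (λ z → 𝟙 (P z))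

  countTrue≡count : ∀ m P → countTrue m P ≡ count m P
  countTrue≡count m P = trans (cong List.sum (map-upTo _ m)) (sum-applyUpTo m _)
    where
    sum-applyUpTo : ∀ m f → List.sum (applyUpTo f m) ≡ ∑< m f
    sum-applyUpTo zero    f = refl
    sum-applyUpTo (suc m) f = cong (f 0 +_) (sum-applyUpTo m (λ i → f (suc i)))

  count-cong : ∀ m {P Q : ℕ → Bool} → (∀ z → z < m → P z ≡ Q z) → count m P ≡ count m Q
  count-cong m eq = ∑<-cong m (λ z z<m → cong 𝟙 (eq z z<m))

  count-mono : ∀ m (P Q : ℕ → Bool) → (∀ z → z < m → T (P z) → T (Q z)) → count m P ≤ count m Q
  count-mono m P Q P⇒Q = ∑<-mono-≤ m (λ z z<m → 𝟙-mono (P⇒Q z z<m))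
    where
    𝟙-mono : ∀ {a b} → (T a → T b) → 𝟙 a ≤ 𝟙 b
    𝟙-mono {false}         _ = z≤n
    𝟙-mono {true} {true}   _ = ≤-refl
    𝟙-mono {true} {false} a⇒b = ⊥-elim (a⇒b _)

  count-none : ∀ m (P : ℕ → Bool) → (∀ z → z < m → T (P z) → ⊥) → count m P ≡ 0
  count-none zero    _ _    = refl
  count-none (suc m) P none with P 0 in P0
  ... | true  = ⊥-elim (none 0 z<s (subst T (sym P0) _))
  ... | false = count-none m (λ z → P (suc z)) (λ z z<m → none (suc z) (s<s z<m))

  0<count⇒∃ : ∀ m (P : ℕ → Bool) → 0 < count m P → ∃[ z ] (z < m × T (P z))
  0<count⇒∃ (suc m) P pos with P 0 in P0
  ... | true  = 0 , z<s , subst T (sym P0) _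
  ... | false with 0<count⇒∃ m (λ z → P (suc z)) pos
  ...   | z , z<m , Pz = suc z , s<s z<m , Pz

  count-∨ : ∀ m (P Q : ℕ → Bool) → count m (λ z → P z ∨ Q z) ≤ count m P + count m Q
  count-∨ m P Q = ≤-trans (∑<-mono-≤ m (λ z _ → 𝟙-∨ (P z) (Q z)))
                          (≤-reflexive (∑<-distrib-+ m (𝟙 ∘ P) (𝟙 ∘ Q)))
    where
    𝟙-∨ : ∀ a b → 𝟙 (a ∨ b) ≤ 𝟙 a + 𝟙 b
    𝟙-∨ false b = ≤-refl
    𝟙-∨ true  b = s≤s z≤n

  count-a== : ∀ m a → a < m → count m (a ==_) ≡ 1
  count-a== (suc m) zero    _         = cong suc (count-none m _ (λ _ _ ()))
  count-a== (suc m) (suc a) (s<s a<m) = trans (count-cong m (λ z _ → ==-suc {z})) (count-a== m a a<m)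
    where
    ==-suc : ∀ {b} → (suc a == suc b) ≡ (a == b)
    ==-suc = T-ext (fromWitness ∘ suc-injective ∘ toWitness) (fromWitness ∘ cong suc ∘ toWitness)

  count-==a : ∀ m a → a < m → count m (_== a) ≡ 1
  count-==a m a a<m = trans (count-cong m (λ z _ → ==-comm z a)) (count-a== m a a<m)

  count-remove : ∀ m (P : ℕ → Bool) a → a < m → T (P a) →
                 count m P ≡ suc (count m (λ z → P z ∧ not (z == a)))
  count-remove m P a a<m Pa = begin
    count m P                              ≡⟨ ∑<-cong m (λ z _ → split (P z) (z == a)) ⟩
    ∑< m (λ z → 𝟙 (rest z) + 𝟙 (only z))   ≡⟨ ∑<-distrib-+ m (𝟙 ∘ rest) (𝟙 ∘ only) ⟩
    count m rest + count m only            ≡⟨ cong (count m rest +_) single ⟩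
    count m rest + 1                       ≡⟨ +-comm _ 1 ⟩
    suc (count m rest)                     ∎
    where
    open ≡-Reasoning
    rest only : ℕ → Bool
    rest z = P z ∧ not (z == a)
    only z = P z ∧ z == a
    split : ∀ x y → 𝟙 x ≡ 𝟙 (x ∧ not y) + 𝟙 (x ∧ y)
    split false _     = refl
    split true  false = refl
    split true  true  = refl
    only-a : ∀ z → z < m → (P z ∧ z == a) ≡ (a == z)
    only-a z _ = T-ext (λ t → fromWitness (sym (toWitness (proj₂ (Equivalence.to (T-∧ {P z}) t)))))
                       (λ t → let a≡z = toWitness t in
                              Equivalence.from (T-∧ {P z}) (subst (T ∘ P) a≡z Pa , fromWitness (sym a≡z)))
    single : count m only ≡ 1
    single = trans (count-cong m only-a) (count-a== m a a<m)

  count-fibres : ∀ k m (g : ℕ → ℕ) → (∀ x → x < m → g x < k) → ∑< k (λ s → count m (λ x → g x == s)) ≡ m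
  count-fibres k m g g<k = begin
    ∑< k (λ s → count m (λ x → g x == s)) ≡⟨ ∑<-comm k m (λ s x → 𝟙 (g x == s)) ⟩
    ∑< m (λ x → count k (g x ==_))       ≡⟨ ∑<-cong m (λ x x<m → count-a== k (g x) (g<k x x<m)) ⟩
    ∑< m (λ _ → 1)                        ≡⟨ ∑<-const m 1 ⟩
    m * 1                                 ≡⟨ *-identityʳ m ⟩
    m                                     ∎
    where open ≡-Reasoning

  any-upTo⇔ : ∀ m (f : ℕ → Bool) → T (any f (upTo m)) ⇔ (∃[ x ] (x < m × T (f x)))
  any-upTo⇔ m f = mk⇔
    (λ t → let x , x∈upTo , fx = find (any⁻ f (upTo m) t) in x , ∈-upTo⁻ x∈upTo , fx)
    (λ { (x , x<m , fx) → any⁺ f (lose (∈-upTo⁺ x<m) fx) })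

module Congruence where

  open import Data.Nat as ℕ using (ℕ; NonZero; _%_; _/_)
  import Data.Nat.Properties as ℕ
  import Data.Nat.Divisibility as ℕ
  open import Data.Nat.DivMod using (m≡m%n+[m/n]*n; m%n<n; m<n⇒m%n≡m)
  open import Data.Integer using (ℤ; +_; -_; _+_; _-_; _*_; _^_; ∣_∣)
  open import Data.Nat.GCD using (gcd; gcd-GCD; module Bézout)
  open Bézout using (Identity; identity; +-; -+)
  open import Data.Integer.Properties
    using ( +-identityʳ; *-identityʳ; ^-*-assoc; ^-zeroˡ; ^-distribˡ-+-*; pos-+; pos-*; +-injective
          ; [+m]-[+n]≡m⊖n; ∣m⊝n∣≤m⊔n; ∣i∣≡0⇒i≡0; i-j≡0⇒i≡j)
  open import Data.Integer.Divisibility.Signed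
  open import Data.Integer.Tactic.RingSolver using (solve-∀)
  open import Data.Empty using (⊥-elim)
  open import Relation.Binary.PropositionalEquality
  open import Relation.Binary.Bundles using (Setoid)
  import Relation.Binary.Reasoning.Setoid as SetoidReasoning

  infix 4 _≡_[mod_]
  record _≡_[mod_] (a b : ℤ) (k : ℕ) : Set where
    constructor ≡mod
    field ∣-difference : + k ∣ a - b
  open _≡_[mod_] public

  module _ {k : ℕ} where

    ∣-≡ : ∀ {a b} → a ≡ b → + k ∣ a → + k ∣ b
    ∣-≡ = subst (+ k ∣_)

    ≡mod-reflexive : ∀ {a b} → a ≡ b → a ≡ b [mod k ]
    ≡mod-reflexive {a} refl = ≡mod (divides (+ 0) (lemma a))
      where
      lemma : ∀ a → a - a ≡ + 0 * + k
      lemma = solve-∀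

    ≡mod-refl : ∀ {a} → a ≡ a [mod k ]
    ≡mod-refl = ≡mod-reflexive refl

    ≡mod-sym : ∀ {a b} → a ≡ b [mod k ] → b ≡ a [mod k ]
    ≡mod-sym {a} {b} (≡mod k∣a-b) = ≡mod (∣-≡ (lemma a b) (∣m⇒∣-m k∣a-b))
      where
      lemma : ∀ a b → - (a - b) ≡ b - a
      lemma = solve-∀

    ≡mod-trans : ∀ {a b c} → a ≡ b [mod k ] → b ≡ c [mod k ] → a ≡ c [mod k ]
    ≡mod-trans {a} {b} {c} (≡mod k∣a-b) (≡mod k∣b-c) = ≡mod (∣-≡ (lemma a b c) (∣m∣n⇒∣m+n k∣a-b k∣b-c))
      where
      lemma : ∀ a b c → (a - b) + (b - c) ≡ a - c
      lemma = solve-∀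

    +-cong-≡mod : ∀ {a b c d} → a ≡ b [mod k ] → c ≡ d [mod k ] → a + c ≡ b + d [mod k ]
    +-cong-≡mod {a} {b} {c} {d} (≡mod k∣a-b) (≡mod k∣c-d) =
      ≡mod (∣-≡ (lemma a b c d) (∣m∣n⇒∣m+n k∣a-b k∣c-d))
      where
      lemma : ∀ a b c d → (a - b) + (c - d) ≡ (a + c) - (b + d)
      lemma = solve-∀

    *-cong-≡mod : ∀ {a b c d} → a ≡ b [mod k ] → c ≡ d [mod k ] → a * c ≡ b * d [mod k ]
    *-cong-≡mod {a} {b} {c} {d} (≡mod k∣a-b) (≡mod k∣c-d) =
      ≡mod (∣-≡ (lemma a b c d) (∣m∣n⇒∣m+n (∣n⇒∣m*n c k∣a-b) (∣n⇒∣m*n b k∣c-d)))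
      where
      lemma : ∀ a b c d → c * (a - b) + b * (c - d) ≡ a * c - b * d
      lemma = solve-∀

    ^-cong-≡mod : ∀ {a b} n → a ≡ b [mod k ] → a ^ n ≡ b ^ n [mod k ]
    ^-cong-≡mod ℕ.zero    _   = ≡mod-refl
    ^-cong-≡mod (ℕ.suc n) a≡b = *-cong-≡mod a≡b (^-cong-≡mod n a≡b)

    ∣⇒≡mod0 : ∀ {a} → + k ∣ a → a ≡ + 0 [mod k ]
    ∣⇒≡mod0 {a} k∣a = ≡mod (∣-≡ (sym (+-identityʳ a)) k∣a)

  ≡mod-setoid : ℕ → Setoid _ _
  ≡mod-setoid k = record
    { Carrier = ℤ
    ; _≈_ = λ a b → a ≡ b [mod k ]
    ; isEquivalence = record { refl = ≡mod-refl ; sym = ≡mod-sym ; trans = ≡mod-trans }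
    }

  module ≡mod-Reasoning (k : ℕ) = SetoidReasoning (≡mod-setoid k)

  ∣∧<⇒≡0 : ∀ {k n} → k ℕ.∣ n → n ℕ.< k → n ≡ 0
  ∣∧<⇒≡0 {n = ℕ.zero}  _   _   = refl
  ∣∧<⇒≡0 {n = ℕ.suc n} k∣n n<k = ⊥-elim (ℕ.<⇒≱ n<k (ℕ.∣⇒≤ k∣n))

  ≡mod-<⇒≡ : ∀ {k x y} → x ℕ.< k → y ℕ.< k → + x ≡ + y [mod k ] → x ≡ y
  ≡mod-<⇒≡ {k} {x} {y} x<k y<k (≡mod k∣x-y) = +-injective (i-j≡0⇒i≡j (+ x) (+ y) (∣i∣≡0⇒i≡0 ∣x-y∣≡0))
    where
    ∣x-y∣<k : ∣ + x - + y ∣ ℕ.< k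
    ∣x-y∣<k = ℕ.≤-<-trans (ℕ.≤-reflexive (cong ∣_∣ ([+m]-[+n]≡m⊖n x y)))
                          (ℕ.≤-<-trans (∣m⊝n∣≤m⊔n x y) (ℕ.⊔-lub x<k y<k))
    ∣x-y∣≡0 : ∣ + x - + y ∣ ≡ 0
    ∣x-y∣≡0 = ∣∧<⇒≡0 (∣⇒∣ᵤ k∣x-y) ∣x-y∣<k

  pos-^ : ∀ a n → + (a ℕ.^ n) ≡ (+ a) ^ n
  pos-^ a ℕ.zero    = refl
  pos-^ a (ℕ.suc n) = trans (pos-* a (a ℕ.^ n)) (cong (+ a *_) (pos-^ a n))

  module _ {k : ℕ} .{{_ : NonZero k}} where

    ≡mod-% : ∀ a → + a ≡ + (a % k) [mod k ]
    ≡mod-% a = ≡mod (divides (+ (a / k)) (begin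
      + a - + (a % k)                       ≡⟨ cong (λ x → + x - + (a % k)) (m≡m%n+[m/n]*n a k) ⟩
      + (a % k ℕ.+ a / k ℕ.* k) - + (a % k) ≡⟨ cong (_- + (a % k)) (pos-+ (a % k) (a / k ℕ.* k)) ⟩
      + (a % k) + + (a / k ℕ.* k) - + (a % k) ≡⟨ cong (λ x → + (a % k) + x - + (a % k)) (pos-* (a / k) k) ⟩
      + (a % k) + + (a / k) * + k - + (a % k) ≡⟨ lemma (+ (a % k)) (+ (a / k) * + k) ⟩
      + (a / k) * + k                         ∎))
      where
      open ≡-Reasoning
      lemma : ∀ r q → r + q - r ≡ q
      lemma = solve-∀

    %≡⇒≡mod : ∀ {a b} → a % k ≡ b % k → + a ≡ + b [mod k ]
    %≡⇒≡mod {a} {b} eq =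
      ≡mod-trans (≡mod-% a) (≡mod-trans (≡mod-reflexive (cong +_ eq)) (≡mod-sym (≡mod-% b)))

    ≡mod⇒%≡ : ∀ {a b} → + a ≡ + b [mod k ] → a % k ≡ b % k
    ≡mod⇒%≡ {a} {b} a≡b = ≡mod-<⇒≡ (m%n<n a k) (m%n<n b k)
      (≡mod-trans (≡mod-sym (≡mod-% a)) (≡mod-trans a≡b (≡mod-% b)))

    %≡⇒≡mod-< : ∀ {a s} → s ℕ.< k → a % k ≡ s → + a ≡ + s [mod k ]
    %≡⇒≡mod-< s<k eq = %≡⇒≡mod (trans eq (sym (m<n⇒m%n≡m s<k)))

    ≡mod⇒%≡-< : ∀ {a s} → s ℕ.< k → + a ≡ + s [mod k ] → a % k ≡ s
    ≡mod⇒%≡-< s<k a≡s = trans (≡mod⇒%≡ a≡s) (m<n⇒m%n≡m s<k)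

    ^%≡⇒≡mod : ∀ {x e s} → s ℕ.< k → x ℕ.^ e % k ≡ s → (+ x) ^ e ≡ + s [mod k ]
    ^%≡⇒≡mod {x} {e} s<k eq = subst (_≡ _ [mod k ]) (pos-^ x e) (%≡⇒≡mod-< s<k eq)

    ≡mod⇒^%≡ : ∀ {x e s} → s ℕ.< k → (+ x) ^ e ≡ + s [mod k ] → x ℕ.^ e % k ≡ s
    ≡mod⇒^%≡ {x} {e} s<k eq = ≡mod⇒%≡-< s<k (subst (_≡ _ [mod k ]) (sym (pos-^ x e)) eq)

  module _ {k : ℕ} {x : ℤ} where

    ^≡1⇒^*≡1 : ∀ {a} t → x ^ a ≡ + 1 [mod k ] → x ^ (t ℕ.* a) ≡ + 1 [mod k ]
    ^≡1⇒^*≡1 {a} t xᵃ≡1 = begin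
      x ^ (t ℕ.* a) ≡⟨ cong (x ^_) (ℕ.*-comm t a) ⟩
      x ^ (a ℕ.* t) ≡⟨ sym (^-*-assoc x a t) ⟩
      (x ^ a) ^ t   ≈⟨ ^-cong-≡mod t xᵃ≡1 ⟩
      (+ 1) ^ t     ≡⟨ ^-zeroˡ t ⟩
      + 1           ∎
      where open ≡mod-Reasoning k

    ^≡1-cancel : ∀ {g c} → x ^ c ≡ + 1 [mod k ] → x ^ (g ℕ.+ c) ≡ + 1 [mod k ] → x ^ g ≡ + 1 [mod k ]
    ^≡1-cancel {g} {c} xᶜ≡1 xᵍ⁺ᶜ≡1 = begin
      x ^ g             ≡⟨ sym (*-identityʳ (x ^ g)) ⟩
      x ^ g * + 1       ≈⟨ *-cong-≡mod (≡mod-refl {a = x ^ g}) (≡mod-sym xᶜ≡1) ⟩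
      x ^ g * x ^ c     ≡⟨ sym (^-distribˡ-+-* x g c) ⟩
      x ^ (g ℕ.+ c)     ≈⟨ xᵍ⁺ᶜ≡1 ⟩
      + 1               ∎
      where open ≡mod-Reasoning k

    ^≡1-gcd : ∀ {a b} → x ^ a ≡ + 1 [mod k ] → x ^ b ≡ + 1 [mod k ] → x ^ gcd a b ≡ + 1 [mod k ]
    ^≡1-gcd {a} {b} xᵃ≡1 xᵇ≡1 = from-identity (identity (gcd-GCD a b))
      where
      x^_≡1 : ℕ → Set
      x^ e ≡1 = x ^ e ≡ + 1 [mod k ]
      from-identity : Identity (gcd a b) a b → x^ gcd a b ≡1
      from-identity (+- s t g+tb≡sa) =
        ^≡1-cancel {gcd a b} {t ℕ.* b} (^≡1⇒^*≡1 t xᵇ≡1) (subst x^_≡1 (sym g+tb≡sa) (^≡1⇒^*≡1 s xᵃ≡1))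
      from-identity (-+ s t g+sa≡tb) =
        ^≡1-cancel {gcd a b} {s ℕ.* a} (^≡1⇒^*≡1 s xᵃ≡1) (subst x^_≡1 (sym g+sa≡tb) (^≡1⇒^*≡1 t xᵇ≡1))

module Binomial where

  open import Data.Nat
  open import Data.Nat.Properties
  open import Data.Nat.Divisibility using (_∣_; ∣m∣n⇒∣m+n; ∣m⇒∣m*n; divides)
  open import Data.Nat.DivMod using (%-remove-+ˡ; m*[n/m]≡n)
  open import Data.Nat.Combinatorics using (_C_; nCn≡1; nCk≡n!/k![n-k]!; k![n∸k]!∣n!)
  open import Data.Fin using (Fin; zero; suc; toℕ; inject₁; fromℕ)
  open import Data.Fin.Properties using (toℕ<n; toℕ-inject₁; toℕ-fromℕ)
  open import Function using (_∘_)
  open import Relation.Binary.PropositionalEquality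
  import Algebra.Definitions.RawMonoid as RawMonoid
  import Algebra.Properties.Semiring.Binomial as SemiringBinomial
  open import Algebra.Properties.Monoid.Sum +-0-monoid using (sum; sum-init-last)

  ×≡* : ∀ n x → RawMonoid._×_ +-0-rawMonoid n x ≡ n * x
  ×≡* zero    x = refl
  ×≡* (suc n) x = cong (x +_) (×≡* n x)

  ×≡^ : ∀ n x → RawMonoid._×_ *-1-rawMonoid n x ≡ x ^ n
  ×≡^ zero    x = refl
  ×≡^ (suc n) x = cong (x *_) (×≡^ n x)

  k![n∸k]!*nCk≡n! : ∀ {n k} → k ≤ n → k ! * (n ∸ k) ! * (n C k) ≡ n !
  k![n∸k]!*nCk≡n! {n} {k} k≤n = trans (cong (k ! * (n ∸ k) ! *_) (nCk≡n!/k![n-k]! k≤n))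
    (m*[n/m]≡n {{k !* (n ∸ k) !≢0}} (k![n∸k]!∣n! k≤n))

  ∣-sum : ∀ {d n} (t : Fin n → ℕ) → (∀ i → d ∣ t i) → d ∣ sum t
  ∣-sum {n = zero}  t d∣t = divides 0 refl
  ∣-sum {n = suc n} t d∣t = ∣m∣n⇒∣m+n (d∣t zero) (∣-sum (λ i → t (suc i)) (λ i → d∣t (suc i)))

  +^≡^+^-mod : ∀ {d} .{{_ : NonZero d}} q → (∀ k → 0 < k → k ≤ q → d ∣ suc q C k) →
               ∀ a b → (a + b) ^ suc q % d ≡ (a ^ suc q + b ^ suc q) % d
  +^≡^+^-mod {d} q d∣C a b = begin
    (a + b) ^ n % d                  ≡⟨ cong (_% d) expansion ⟩
    (b ^ n + (inner + a ^ n)) % d    ≡⟨ cong (_% d) (x+[y+z]≡y+[z+x] (b ^ n) inner (a ^ n)) ⟩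
    (inner + (a ^ n + b ^ n)) % d    ≡⟨ %-remove-+ˡ (a ^ n + b ^ n) (∣-sum _ d∣inner) ⟩
    (a ^ n + b ^ n) % d              ∎
    where
    open ≡-Reasoning
    open SemiringBinomial +-*-semiring a b using (binomialTerm; theorem)
    n = suc q
    term : ∀ k → binomialTerm n k ≡ (n C toℕ k) * (a ^ toℕ k * b ^ (n ∸ toℕ k))
    term k = trans (×≡* (n C toℕ k) _)
                   (cong₂ (λ u v → (n C toℕ k) * (u * v)) (×≡^ (toℕ k) a) (×≡^ (n ∸ toℕ k) b))
    inner-term : Fin q → ℕ
    inner-term i = binomialTerm n (suc (inject₁ i))
    inner = sum inner-term
    d∣inner : ∀ i → d ∣ inner-term i
    d∣inner i = subst (d ∣_) (sym (term (suc (inject₁ i))))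
      (∣m⇒∣m*n _ (d∣C (suc (toℕ (inject₁ i))) z<s (subst (_< q) (sym (toℕ-inject₁ i)) (toℕ<n i))))
    first : binomialTerm n zero ≡ b ^ n
    first = trans (term zero) (trans (*-identityˡ _) (*-identityˡ _))
    last : binomialTerm n (suc (fromℕ q)) ≡ a ^ n
    last = begin
      binomialTerm n (suc (fromℕ q))           ≡⟨ term (suc (fromℕ q)) ⟩
      (n C m) * (a ^ m * b ^ (n ∸ m))          ≡⟨ cong (λ k → (n C k) * (a ^ k * b ^ (n ∸ k))) m≡n ⟩
      (n C n) * (a ^ n * b ^ (n ∸ n))          ≡⟨ cong₂ (λ c e → c * (a ^ n * b ^ e)) (nCn≡1 n) (n∸n≡0 n) ⟩
      1 * (a ^ n * 1)                          ≡⟨ trans (*-identityˡ _) (*-identityʳ _) ⟩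
      a ^ n                                    ∎
      where
      m = toℕ (suc (fromℕ q))
      m≡n = cong suc (toℕ-fromℕ q)
    expansion : (a + b) ^ n ≡ b ^ n + (inner + a ^ n)
    expansion = begin
      (a + b) ^ n                                      ≡⟨ sym (×≡^ n (a + b)) ⟩
      RawMonoid._×_ *-1-rawMonoid n (a + b)            ≡⟨ theorem (*-comm a b) n ⟩
      binomialTerm n zero + sum (binomialTerm n ∘ suc) ≡⟨ cong₂ _+_ first (sum-init-last (binomialTerm n ∘ suc)) ⟩
      b ^ n + (inner + binomialTerm n (suc (fromℕ q))) ≡⟨ cong (λ x → b ^ n + (inner + x)) last ⟩
      b ^ n + (inner + a ^ n)                          ∎
    x+[y+z]≡y+[z+x] : ∀ x y z → x + (y + z) ≡ y + (z + x)
    x+[y+z]≡y+[z+x] x y z = trans (+-comm x (y + z)) (+-assoc y z x)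

module MonicPolynomials where

  open import Data.Nat using (ℕ; zero; suc)
  open import Data.Integer using (ℤ; +_; -_; _+_; _-_; _*_; _^_)
  open import Data.Integer.Properties using (+-comm; +-identityˡ)
  open import Data.Integer.Tactic.RingSolver using (solve-∀)
  open import Data.Product using (Σ; _×_; _,_)
  open import Relation.Binary.PropositionalEquality

  -- A polynomial is represented by its values together with a Horner decomposition f x = c + x * g x.
  data Monic : ℕ → (ℤ → ℤ) → Set where
    monic-one : ∀ {f} → (∀ x → f x ≡ + 1) → Monic 0 f
    monic-suc : ∀ {k f g} c → Monic k g → (∀ x → f x ≡ c + x * g x) → Monic (suc k) f

  monic-^ : ∀ k → Monic k (_^ k)
  monic-^ zero    = monic-one (λ _ → refl)
  monic-^ (suc k) = monic-suc (+ 0) (monic-^ k) (λ x → sym (+-identityˡ _))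

  monic-^-c : ∀ k c → Monic (suc k) (λ x → x ^ suc k - c)
  monic-^-c k c = monic-suc (- c) (monic-^ k) (λ x → +-comm (x ^ suc k) (- c))

  monic-+* : ∀ {k f g} → Monic (suc k) f → Monic k g → ∀ a → Monic (suc k) (λ x → f x + a * g x)
  monic-+* (monic-suc {g = F} c (monic-one F≡1) f≡) (monic-one g≡1) a =
    monic-suc (c + a) (monic-one F≡1)
      (λ x → trans (cong₂ (λ u v → u + a * v) (f≡ x) (g≡1 x)) (lemma c x (F x) a))
    where
    lemma : ∀ c x F a → c + x * F + a * + 1 ≡ c + a + x * F
    lemma = solve-∀
  monic-+* (monic-suc {g = F} c mF f≡) (monic-suc {g = G} c′ mG g≡) a =
    monic-suc (c + a * c′) (monic-+* mF mG a)
      (λ x → trans (cong₂ (λ u v → u + a * v) (f≡ x) (g≡ x)) (lemma c x (F x) a c′ (G x)))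
    where
    lemma : ∀ c x F a c′ G → c + x * F + a * (c′ + x * G) ≡ c + a * c′ + x * (F + a * G)
    lemma = solve-∀

  factor-theorem : ∀ {k f} → Monic (suc k) f → ∀ a →
                   Σ (ℤ → ℤ) (λ q → Monic k q × (∀ x → f x - f a ≡ (x - a) * q x))
  factor-theorem {f = f} (monic-suc {g = F} c (monic-one F≡1) f≡) a =
    (λ _ → + 1) , monic-one (λ _ → refl) , λ x → begin
      f x - f a                     ≡⟨ cong₂ _-_ (f≡ x) (f≡ a) ⟩
      c + x * F x - (c + a * F a)   ≡⟨ cong₂ (λ u v → c + x * u - (c + a * v)) (F≡1 x) (F≡1 a) ⟩
      c + x * + 1 - (c + a * + 1)   ≡⟨ lemma c x a ⟩
      (x - a) * + 1                 ∎
    where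
    open ≡-Reasoning
    lemma : ∀ c x a → c + x * + 1 - (c + a * + 1) ≡ (x - a) * + 1
    lemma = solve-∀
  factor-theorem {f = f} (monic-suc {k = suc k} {g = F} c mF f≡) a with factor-theorem mF a
  ... | q , mq , F≡ = (λ x → F x + a * q x) , monic-+* mF mq a , λ x → begin
      f x - f a                                ≡⟨ cong₂ _-_ (f≡ x) (f≡ a) ⟩
      c + x * F x - (c + a * F a)              ≡⟨ lemma₁ c x a (F x) (F a) ⟩
      (x - a) * F x + a * (F x - F a)          ≡⟨ cong (λ t → (x - a) * F x + a * t) (F≡ x) ⟩
      (x - a) * F x + a * ((x - a) * q x)      ≡⟨ lemma₂ x a (F x) (q x) ⟩
      (x - a) * (F x + a * q x)                ∎
    where
    open ≡-Reasoning
    lemma₁ : ∀ c x a Fx Fa → c + x * Fx - (c + a * Fa) ≡ (x - a) * Fx + a * (Fx - Fa)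
    lemma₁ = solve-∀
    lemma₂ : ∀ x a Fx qx → (x - a) * Fx + a * ((x - a) * qx) ≡ (x - a) * (Fx + a * qx)
    lemma₂ = solve-∀

module ModuloPrime {p : ℕ} (prime : Prime p) where

  open import Data.Nat as ℕ using (ℕ; zero; suc; NonZero; z<s; s<s; _!)
  import Data.Nat.Properties as ℕ
  import Data.Nat.Divisibility as ℕ
  open import Data.Nat.Combinatorics using (_C_)
  open import Data.Nat.Primality using (euclidsLemma; prime⇒nonZero; prime⇒nonTrivial)
  open import Data.Integer using (ℤ; +_; -_; _+_; _-_; _*_; _^_; ∣_∣)
  open import Data.Integer.Properties using (pos-+; pos-*; abs-*; *-identityʳ)
  open import Data.Integer.Divisibility.Signed
  open import Data.Integer.Tactic.RingSolver using (solve-∀)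
  open import Data.Bool using (Bool; T; _∨_)
  open import Data.Bool.Properties using (T-∨)
  open import Data.Product using (_,_)
  open import Data.Sum using (_⊎_; inj₁; inj₂)
  open import Data.Empty using (⊥-elim)
  open import Function using (Equivalence)
  open import Relation.Nullary using (¬_; yes; no)
  open import Relation.Nullary.Decidable using (⌊_⌋; toWitness; fromWitness)
  open import Relation.Binary.PropositionalEquality
  open Counting
  open Congruence
  open Binomial using (k![n∸k]!*nCk≡n!; +^≡^+^-mod)
  open MonicPolynomials

  instance
    p≢0 : NonZero p
    p≢0 = prime⇒nonZero prime

  1<p : 1 ℕ.< p
  1<p = ℕ.nonTrivial⇒n>1 p {{prime⇒nonTrivial prime}}

  0<p : 0 ℕ.< p
  0<p = ℕ.<-trans z<s 1<p

  p≡1+[p∸1] : p ≡ suc (p ℕ.∸ 1)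
  p≡1+[p∸1] = sym (ℕ.suc-pred p)

  p∤1 : ¬ (+ p ∣ + 1)
  p∤1 p∣1 = ℕ.<⇒≱ 1<p (ℕ.∣⇒≤ (∣⇒∣ᵤ p∣1))

  ∣*⇒∣⊎∣ : ∀ a b → + p ∣ a * b → (+ p ∣ a) ⊎ (+ p ∣ b)
  ∣*⇒∣⊎∣ a b p∣ab with euclidsLemma ∣ a ∣ ∣ b ∣ prime (subst (p ℕ.∣_) (abs-* a b) (∣⇒∣ᵤ p∣ab))
  ... | inj₁ p∣a = inj₁ (∣ᵤ⇒∣ p∣a)
  ... | inj₂ p∣b = inj₂ (∣ᵤ⇒∣ p∣b)

  *-cancelˡ-≡mod : ∀ {a b c} → ¬ (+ p ∣ a) → a * b ≡ a * c [mod p ] → b ≡ c [mod p ]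
  *-cancelˡ-≡mod {a} {b} {c} p∤a (≡mod p∣ab-ac) with ∣*⇒∣⊎∣ a (b - c) (∣-≡ (lemma a b c) p∣ab-ac)
    where
    lemma : ∀ a b c → a * b - a * c ≡ a * (b - c)
    lemma = solve-∀
  ... | inj₁ p∣a   = ⊥-elim (p∤a p∣a)
  ... | inj₂ p∣b-c = ≡mod p∣b-c

  p∤m! : ∀ m → m ℕ.< p → ¬ (p ℕ.∣ m !)
  p∤m! zero    _   p∣1 = ℕ.<⇒≱ 1<p (ℕ.∣⇒≤ p∣1)
  p∤m! (suc m) m<p p∣m! with euclidsLemma (suc m) (m !) prime p∣m!
  ... | inj₁ p∣1+m = ℕ.<⇒≱ m<p (ℕ.∣⇒≤ p∣1+m)
  ... | inj₂ p∣m!′ = p∤m! m (ℕ.<-trans (ℕ.n<1+n m) m<p) p∣m!′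

  p∣pCk : ∀ {k} → 0 ℕ.< k → k ℕ.< p → p ℕ.∣ p C k
  p∣pCk {k} 0<k k<p with euclidsLemma (k ! ℕ.* (p ℕ.∸ k) !) (p C k) prime p∣k![p∸k]!*pCk
    where
    p∣k![p∸k]!*pCk : p ℕ.∣ k ! ℕ.* (p ℕ.∸ k) ! ℕ.* (p C k)
    p∣k![p∸k]!*pCk = subst (p ℕ.∣_) (sym (k![n∸k]!*nCk≡n! (ℕ.<⇒≤ k<p)))
                            (subst (λ n → n ℕ.∣ n !) (sym p≡1+[p∸1]) (ℕ.m∣m*n ((p ℕ.∸ 1) !)))
  ... | inj₂ p∣pCk′ = p∣pCk′
  ... | inj₁ p∣k!*[p∸k]! with euclidsLemma (k !) ((p ℕ.∸ k) !) prime p∣k!*[p∸k]!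
  ...   | inj₁ p∣k!      = ⊥-elim (p∤m! k k<p p∣k!)
  ...   | inj₂ p∣[p∸k]! = ⊥-elim (p∤m! (p ℕ.∸ k) (ℕ.∸-monoʳ-< 0<k (ℕ.<⇒≤ k<p)) p∣[p∸k]!)

  freshmans-dream : ∀ a b → (a ℕ.+ b) ℕ.^ p ℕ.% p ≡ (a ℕ.^ p ℕ.+ b ℕ.^ p) ℕ.% p
  freshmans-dream =
    subst (λ n → ∀ a b → (a ℕ.+ b) ℕ.^ n ℕ.% p ≡ (a ℕ.^ n ℕ.+ b ℕ.^ n) ℕ.% p) (sym p≡1+[p∸1])
    (+^≡^+^-mod (p ℕ.∸ 1) (λ k 0<k k≤p∸1 → subst (λ n → p ℕ.∣ n C k) p≡1+[p∸1]
                                              (p∣pCk 0<k (subst (k ℕ.<_) (sym p≡1+[p∸1]) (s<s k≤p∸1)))))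

  a^p≡a : ∀ a → (+ a) ^ p ≡ + a [mod p ]
  a^p≡a zero    = ≡mod-reflexive (subst (λ n → (+ 0) ^ n ≡ + 0) (sym p≡1+[p∸1]) refl)
  a^p≡a (suc a) = begin
    (+ suc a) ^ p          ≡⟨ sym (pos-^ (suc a) p) ⟩
    + (suc a ℕ.^ p)        ≈⟨ %≡⇒≡mod (freshmans-dream 1 a) ⟩
    + (1 ℕ.^ p ℕ.+ a ℕ.^ p) ≡⟨ cong (λ x → + (x ℕ.+ a ℕ.^ p)) (ℕ.^-zeroˡ p) ⟩
    + (1 ℕ.+ a ℕ.^ p)      ≡⟨ trans (pos-+ 1 (a ℕ.^ p)) (cong (_+_ (+ 1)) (pos-^ a p)) ⟩
    + 1 + (+ a) ^ p        ≈⟨ +-cong-≡mod (≡mod-refl {a = + 1}) (a^p≡a a) ⟩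
    + 1 + + a              ≡⟨ sym (pos-+ 1 a) ⟩
    + suc a                ∎
    where open ≡mod-Reasoning p

  fermat : ∀ a → ¬ (+ p ∣ + a) → (+ a) ^ (p ℕ.∸ 1) ≡ + 1 [mod p ]
  fermat a p∤a = *-cancelˡ-≡mod p∤a (begin
    (+ a) ^ suc (p ℕ.∸ 1) ≡⟨ cong ((+ a) ^_) (sym p≡1+[p∸1]) ⟩
    (+ a) ^ p             ≈⟨ a^p≡a a ⟩
    + a                   ≡⟨ sym (*-identityʳ (+ a)) ⟩
    + a * + 1             ∎)
    where open ≡mod-Reasoning p

  root? : (ℤ → ℤ) → ℕ → Bool
  root? f z = ⌊ + p ∣? f (+ z) ⌋

  roots≤degree : ∀ {k f} → Monic k f → count p (root? f) ℕ.≤ k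
  roots≤degree {zero} {f} (monic-one f≡1) =
    ℕ.≤-reflexive (count-none p (root? f) λ z _ fz≡0 → p∤1 (subst (+ p ∣_) (f≡1 (+ z)) (toWitness fz≡0)))
  roots≤degree {suc k} {f} mf with 0 ℕ.<? count p (root? f)
  ... | no  no-root = ℕ.≤-trans (ℕ.≮⇒≥ no-root) ℕ.z≤n
  ... | yes has-root with 0<count⇒∃ p (root? f) has-root
  ...   | a , a<p , fa≡0 with factor-theorem mf (+ a)
  ...     | q , mq , f≡ = begin
    count p (root? f)                              ≤⟨ count-mono p (root? f) _ root-a-or-q ⟩
    count p (λ z → z == a ∨ root? q z)             ≤⟨ count-∨ p (_== a) (root? q) ⟩
    count p (_== a) ℕ.+ count p (root? q)          ≡⟨ cong (ℕ._+ count p (root? q)) (count-==a p a a<p) ⟩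
    suc (count p (root? q))                        ≤⟨ ℕ.s≤s (roots≤degree mq) ⟩
    suc k                                          ∎
    where
    open ℕ.≤-Reasoning
    root-a-or-q : ∀ z → z ℕ.< p → T (root? f z) → T (z == a ∨ root? q z)
    root-a-or-q z z<p fz≡0 with ∣*⇒∣⊎∣ (+ z - + a) (q (+ z))
                                   (∣-≡ (f≡ (+ z)) (∣m∣n⇒∣m-n (toWitness fz≡0) (toWitness fa≡0)))
    ... | inj₁ p∣z-a = Equivalence.from (T-∨ {z == a}) (inj₁ (fromWitness (≡mod-<⇒≡ z<p a<p (≡mod p∣z-a))))
    ... | inj₂ p∣qz  = Equivalence.from (T-∨ {z == a}) (inj₂ (fromWitness p∣qz))

  p∣x∧x<p⇒x≡0 : ∀ {x} → + p ∣ + x → x ℕ.< p → x ≡ 0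
  p∣x∧x<p⇒x≡0 p∣x x<p = ∣∧<⇒≡0 (∣⇒∣ᵤ p∣x) x<p

  ∣^⇒∣ : ∀ a k → + p ∣ a ^ suc k → + p ∣ a
  ∣^⇒∣ a k p∣aᵏ⁺¹ with ∣*⇒∣⊎∣ a (a ^ k) p∣aᵏ⁺¹
  ∣^⇒∣ a k       _ | inj₁ p∣a  = p∣a
  ∣^⇒∣ a zero    _ | inj₂ p∣1  = ⊥-elim (p∤1 p∣1)
  ∣^⇒∣ a (suc k) _ | inj₂ p∣aᵏ = ∣^⇒∣ a k p∣aᵏ

  p∣x⇒xᵏ%p≡0 : ∀ k .{{_ : NonZero k}} {x} → + p ∣ + x → x ℕ.^ k ℕ.% p ≡ 0
  p∣x⇒xᵏ%p≡0 k {x} p∣x = ≡mod⇒^%≡ {x = x} {e = k} 0<p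
    (∣⇒≡mod0 (subst (λ e → + p ∣ (+ x) ^ e) (ℕ.suc-pred k) (∣m⇒∣m*n ((+ x) ^ ℕ.pred k) p∣x)))

  xᵏ%p≢0⇒p∤x : ∀ k .{{_ : NonZero k}} {x s} → s ≢ 0 → x ℕ.^ k ℕ.% p ≡ s → ¬ (+ p ∣ + x)
  xᵏ%p≢0⇒p∤x k s≢0 xᵏ≡s p∣x = s≢0 (trans (sym xᵏ≡s) (p∣x⇒xᵏ%p≡0 k p∣x))

  count-kthRoots≤k : ∀ k .{{_ : NonZero k}} s → s ℕ.< p → count p (λ x → x ℕ.^ k ℕ.% p == s) ℕ.≤ k
  count-kthRoots≤k (suc k) s s<p = ℕ.≤-trans
    (count-mono p (λ x → x ℕ.^ suc k ℕ.% p == s) (root? (λ x → x ^ suc k - + s))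
      (λ x _ xᵏ≡s → fromWitness (∣-difference (^%≡⇒≡mod {x = x} {e = suc k} s<p (toWitness xᵏ≡s)))))
    (roots≤degree (monic-^-c k (+ s)))

module PowerResidues {p : ℕ} (prime : Prime p) (n : ℕ) .{{_ : NonZero n}} where

  open import Data.Nat as ℕ using (ℕ; suc; NonZero; z<s; _≤_; _%_; _∸_)
  import Data.Nat.Properties as ℕ
  import Data.Nat.Divisibility as ℕ
  open import Data.Nat.DivMod using (m%n<n; m<n⇒m%n≡m)
  open import Data.Nat.GCD using (gcd; gcd[m,n]∣m; gcd[m,n]∣n; gcd[m,n]≢0)
  open import Data.Integer using (+_; _*_; _^_)
  open import Data.Integer.Properties using (^-*-assoc; *-identityʳ; +-identityʳ)
  open import Data.Integer.Divisibility.Signed using (_∣_; divides)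
  open import Data.Bool using (Bool; true; false; T; not; _∧_)
  open import Data.Bool.Properties using (T-∧)
  open import Data.Bool.ListAction using (any)
  open import Data.List using (upTo)
  open import Data.Product using (_,_; proj₁; proj₂)
  open import Data.Sum using (inj₁)
  open import Function using (_∘_; Equivalence)
  open import Relation.Nullary using (¬_; yes; no)
  open import Relation.Nullary.Decidable using (toWitness; fromWitness)
  open import Relation.Binary.PropositionalEquality
  open Counting
  open Congruence
  open ModuloPrime prime

  nthRoot? : ℕ → ℕ → Bool
  nthRoot? s x = x ℕ.^ n % p == s

  fibre : ℕ → ℕ
  fibre s = count p (nthRoot? s)

  nonzeroNthPower? : ℕ → Bool
  nonzeroNthPower? s = not (s == 0) ∧ any (nthRoot? s) (upTo p)

  nonzero-fixed≡nthRootOfUnity : ∀ z → z ℕ.< p →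
                                 (not (z == 0) ∧ z ℕ.^ suc n % p == z) ≡ (z ℕ.^ n % p == 1)
  nonzero-fixed≡nthRootOfUnity z z<p = T-ext fixed⇒ⁿ√1 ⁿ√1⇒fixed
    where
    fixed⇒ⁿ√1 : T (not (z == 0) ∧ z ℕ.^ suc n % p == z) → T (z ℕ.^ n % p == 1)
    fixed⇒ⁿ√1 t = fromWitness (≡mod⇒^%≡ {x = z} {e = n} 1<p (*-cancelˡ-≡mod p∤z (begin
      + z * (+ z) ^ n ≈⟨ ^%≡⇒≡mod {x = z} {e = suc n} z<p (toWitness z¹⁺ⁿ≡z) ⟩
      + z             ≡⟨ sym (*-identityʳ (+ z)) ⟩
      + z * + 1       ∎)))
      where
      open ≡mod-Reasoning p
      z≢0 = proj₁ (Equivalence.to (T-∧ {not (z == 0)}) t)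
      z¹⁺ⁿ≡z = proj₂ (Equivalence.to (T-∧ {not (z == 0)}) t)
      p∤z : ¬ (+ p ∣ + z)
      p∤z p∣z = not-==⇒≢ z≢0 (p∣x∧x<p⇒x≡0 p∣z z<p)
    ⁿ√1⇒fixed : T (z ℕ.^ n % p == 1) → T (not (z == 0) ∧ z ℕ.^ suc n % p == z)
    ⁿ√1⇒fixed t = Equivalence.from (T-∧ {not (z == 0)}) (≢⇒not-== z≢0 , fromWitness z¹⁺ⁿ%p≡z)
      where
      open ≡mod-Reasoning p
      zⁿ≡1 = toWitness t
      z¹⁺ⁿ%p≡z : z ℕ.^ suc n % p ≡ z
      z¹⁺ⁿ%p≡z = ≡mod⇒^%≡ {x = z} {e = suc n} z<p (begin
        + z * (+ z) ^ n ≈⟨ *-cong-≡mod (≡mod-refl {a = + z}) (^%≡⇒≡mod {x = z} {e = n} 1<p zⁿ≡1) ⟩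
        + z * + 1       ≡⟨ *-identityʳ (+ z) ⟩
        + z             ∎)
      z≢0 : z ≢ 0
      z≢0 refl = ℕ.0≢1+n (trans (sym (p∣x⇒xᵏ%p≡0 n {0} (divides (+ 0) refl))) zⁿ≡1)

  fibre₁≥n⇒n∣p∸1 : n ≤ fibre 1 → n ℕ.∣ p ∸ 1
  fibre₁≥n⇒n∣p∸1 n≤fibre₁ = subst (ℕ._∣ p ∸ 1) g≡n (gcd[m,n]∣n n (p ∸ 1))
    where
    g = gcd n (p ∸ 1)
    instance
      g≢0 : NonZero g
      g≢0 = ℕ.≢-nonZero (gcd[m,n]≢0 n (p ∸ 1) (inj₁ (ℕ.≢-nonZero⁻¹ n)))
    ⁿ√1⇒ᵍ√1 : ∀ x → x ℕ.< p → T (x ℕ.^ n % p == 1) → T (x ℕ.^ g % p == 1)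
    ⁿ√1⇒ᵍ√1 x _ t = fromWitness (≡mod⇒^%≡ {x = x} {e = g} 1<p (^≡1-gcd {a = n} {b = p ∸ 1} xⁿ≡1 xᵖ⁻¹≡1))
      where
      xⁿ≡1 = ^%≡⇒≡mod {x = x} {e = n} 1<p (toWitness t)
      xᵖ⁻¹≡1 = fermat x (xᵏ%p≢0⇒p∤x n (λ ()) (toWitness t))
    n≤g : n ≤ g
    n≤g = ℕ.≤-trans n≤fibre₁ (ℕ.≤-trans (count-mono p (nthRoot? 1) (λ x → x ℕ.^ g % p == 1) ⁿ√1⇒ᵍ√1)
                                          (count-kthRoots≤k g 1 1<p))
    g≡n : g ≡ n
    g≡n = ℕ.≤-antisym (ℕ.∣⇒≤ (gcd[m,n]∣m n (p ∸ 1))) n≤g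

  fibre₀≤1 : fibre 0 ≤ 1
  fibre₀≤1 = ℕ.≤-trans (count-mono p (nthRoot? 0) (_== 0) only-0) (ℕ.≤-reflexive (count-==a p 0 0<p))
    where
    only-0 : ∀ x → x ℕ.< p → T (x ℕ.^ n % p == 0) → T (x == 0)
    only-0 x x<p xⁿ≡0 = fromWitness (p∣x∧x<p⇒x≡0 (∣^⇒∣ (+ x) (ℕ.pred n) p∣xⁿ) x<p)
      where
      p∣xⁿ : + p ∣ (+ x) ^ suc (ℕ.pred n)
      p∣xⁿ = ∣-≡ (trans (+-identityʳ _) (cong ((+ x) ^_) (sym (ℕ.suc-pred n))))
                 (∣-difference (^%≡⇒≡mod {x = x} {e = n} 0<p (toWitness xⁿ≡0)))

  module _ {m : ℕ} (p∸1≡n*m : p ∸ 1 ≡ n ℕ.* m) where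

    p≡m*n+1 : p ≡ m ℕ.* n ℕ.+ 1
    p≡m*n+1 = trans p≡1+[p∸1] (trans (ℕ.+-comm 1 (p ∸ 1)) (cong (ℕ._+ 1) (trans p∸1≡n*m (ℕ.*-comm n m))))

    instance
      m≢0 : NonZero m
      m≢0 = ℕ.≢-nonZero λ { refl → ℕ.m>n⇒m∸n≢0 1<p (trans p∸1≡n*m (ℕ.*-zeroʳ n)) }

    ᵐ√1? : ℕ → Bool
    ᵐ√1? s = s ℕ.^ m % p == 1

    ᵐ√1⇒≢0 : ∀ {s} → T (ᵐ√1? s) → s ≢ 0
    ᵐ√1⇒≢0 sᵐ≡1 refl = ℕ.0≢1+n (trans (sym (p∣x⇒xᵏ%p≡0 m (divides (+ 0) refl))) (toWitness sᵐ≡1))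

    nthPower⇒ᵐ√1 : ∀ {x s} → s ≢ 0 → x ℕ.^ n % p ≡ s → T (ᵐ√1? s)
    nthPower⇒ᵐ√1 {x} {s} s≢0 xⁿ≡s = fromWitness (≡mod⇒^%≡ {x = s} {e = m} 1<p (begin
      (+ s) ^ m         ≈⟨ ^-cong-≡mod m (≡mod-sym (^%≡⇒≡mod {x = x} {e = n} s<p xⁿ≡s)) ⟩
      ((+ x) ^ n) ^ m   ≡⟨ ^-*-assoc (+ x) n m ⟩
      (+ x) ^ (n ℕ.* m) ≡⟨ cong ((+ x) ^_) (sym p∸1≡n*m) ⟩
      (+ x) ^ (p ∸ 1)   ≈⟨ fermat x (xᵏ%p≢0⇒p∤x n s≢0 xⁿ≡s) ⟩
      + 1               ∎))
      where
      open ≡mod-Reasoning p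
      s<p = subst (ℕ._< p) xⁿ≡s (m%n<n _ p)

    -- Summing fibre s ≤ bound s over s < p gives p ≤ n · count p ᵐ√1? + 1 ≤ n m + 1 = p,
    -- so every one of these inequalities is an equality.
    bound : ℕ → ℕ
    bound s = 𝟙 (ᵐ√1? s) ℕ.* n ℕ.+ 𝟙 (s == 0)

    fibre≤bound : ∀ s → s ℕ.< p → fibre s ≤ bound s
    fibre≤bound s s<p with s ℕ.≟ 0
    ... | yes refl = ℕ.≤-trans fibre₀≤1 (ℕ.m≤n+m 1 _)
    ... | no  s≢0  = ℕ.≤-trans fibre≤ (ℕ.m≤m+n _ _)
      where
      fibre≤ : fibre s ≤ 𝟙 (ᵐ√1? s) ℕ.* n
      fibre≤ with ᵐ√1? s in sᵐ≡1
      ... | true  = ℕ.≤-trans (count-kthRoots≤k n s s<p) (ℕ.≤-reflexive (sym (ℕ.+-identityʳ n)))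
      ... | false = ℕ.≤-reflexive (count-none p (nthRoot? s) (λ x _ xⁿ≡s →
                      subst T sᵐ≡1 (nthPower⇒ᵐ√1 s≢0 (toWitness xⁿ≡s))))

    ∑<-fibre≡p : ∑< p fibre ≡ p
    ∑<-fibre≡p = count-fibres p p (λ x → x ℕ.^ n % p) (λ x _ → m%n<n _ p)

    ∑<-bound≡ : ∑< p bound ≡ count p ᵐ√1? ℕ.* n ℕ.+ 1
    ∑<-bound≡ = trans (∑<-distrib-+ p (λ s → 𝟙 (ᵐ√1? s) ℕ.* n) (λ s → 𝟙 (s == 0)))
                      (cong₂ ℕ._+_ (∑<-*ʳ p (𝟙 ∘ ᵐ√1?) n) (count-==a p 0 0<p))

    ∑<-fibre≡∑<-bound : ∑< p fibre ≡ ∑< p bound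
    ∑<-fibre≡∑<-bound = ℕ.≤-antisym (∑<-mono-≤ p fibre≤bound) (begin
      ∑< p bound             ≡⟨ ∑<-bound≡ ⟩
      count p ᵐ√1? ℕ.* n ℕ.+ 1 ≤⟨ ℕ.+-monoˡ-≤ 1 (ℕ.*-monoˡ-≤ n (count-kthRoots≤k m 1 1<p)) ⟩
      m ℕ.* n ℕ.+ 1            ≡⟨ sym p≡m*n+1 ⟩
      p                        ≡⟨ sym ∑<-fibre≡p ⟩
      ∑< p fibre               ∎)
      where open ℕ.≤-Reasoning

    fibre-ᵐ√1≡n : ∀ s → s ℕ.< p → T (ᵐ√1? s) → fibre s ≡ n
    fibre-ᵐ√1≡n s s<p sᵐ≡1 = begin
      fibre s                         ≡⟨ ∑<-mono-≤-≡ p fibre≤bound ∑<-fibre≡∑<-bound s s<p ⟩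
      𝟙 (ᵐ√1? s) ℕ.* n ℕ.+ 𝟙 (s == 0) ≡⟨ cong₂ (λ a b → 𝟙 a ℕ.* n ℕ.+ 𝟙 b) (T-ext (λ _ → _) (λ _ → sᵐ≡1))
                                                (T-ext (ᵐ√1⇒≢0 sᵐ≡1 ∘ toWitness) λ ()) ⟩
      1 ℕ.* n ℕ.+ 0                   ≡⟨ trans (ℕ.+-identityʳ _) (ℕ.*-identityˡ n) ⟩
      n                               ∎
      where open ≡-Reasoning

    count-ᵐ√1≡m : count p ᵐ√1? ≡ m
    count-ᵐ√1≡m = ℕ.*-cancelʳ-≡ _ _ n (ℕ.+-cancelʳ-≡ 1 _ _ (begin
      count p ᵐ√1? ℕ.* n ℕ.+ 1 ≡⟨ sym ∑<-bound≡ ⟩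
      ∑< p bound               ≡⟨ sym ∑<-fibre≡∑<-bound ⟩
      ∑< p fibre               ≡⟨ ∑<-fibre≡p ⟩
      p                        ≡⟨ p≡m*n+1 ⟩
      m ℕ.* n ℕ.+ 1            ∎))
      where open ≡-Reasoning

    fibre₁≡n : fibre 1 ≡ n
    fibre₁≡n = fibre-ᵐ√1≡n 1 1<p (fromWitness (trans (cong (_% p) (ℕ.^-zeroˡ m)) (m<n⇒m%n≡m 1<p)))

    count-nonzeroNthPower≡m : count p nonzeroNthPower? ≡ m
    count-nonzeroNthPower≡m =
      trans (count-cong p λ s s<p → T-ext (nonzeroNthPower⇒ᵐ√1 s) (ᵐ√1⇒nonzeroNthPower s s<p)) count-ᵐ√1≡m
      where
      nonzeroNthPower⇒ᵐ√1 : ∀ s → T (nonzeroNthPower? s) → T (ᵐ√1? s)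
      nonzeroNthPower⇒ᵐ√1 s t with Equivalence.to (T-∧ {not (s == 0)}) t
      ... | s≠0 , ∃root with Equivalence.to (any-upTo⇔ p (nthRoot? s)) ∃root
      ...   | x , _ , xⁿ≡s = nthPower⇒ᵐ√1 (not-==⇒≢ s≠0) (toWitness xⁿ≡s)
      ᵐ√1⇒nonzeroNthPower : ∀ s → s ℕ.< p → T (ᵐ√1? s) → T (nonzeroNthPower? s)
      ᵐ√1⇒nonzeroNthPower s s<p sᵐ≡1 = Equivalence.from (T-∧ {not (s == 0)})
        (≢⇒not-== (ᵐ√1⇒≢0 sᵐ≡1) ,
         Equivalence.from (any-upTo⇔ p (nthRoot? s))
           (0<count⇒∃ p (nthRoot? s) (subst (0 ℕ.<_) (sym (fibre-ᵐ√1≡n s s<p sᵐ≡1)) (ℕ.>-nonZero⁻¹ n))))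

module Sentences where

  open import Data.Nat using (ℕ; zero; suc; _≤_; _<_; NonZero; _^_; _*_; _%_; z≤n; s≤s; z<s)
  open import Data.Nat.Properties using (*-identityʳ; ≤-pred; <-≤-trans)
  open import Data.Nat.DivMod using (m<n⇒m%n≡m; %-distribˡ-*; m%n%n≡m%n)
  open import Data.Fin using (Fin; zero; suc; toℕ)
  open import Relation.Nullary.Decidable using (toWitness; fromWitness)
  open import Data.Bool using (Bool; true; not; _∧_; T)
  open import Data.Bool.Properties using (T-∧; ∧-assoc; ∧-comm; ∧-identityʳ)
  open import Data.Product using (_,_)
  open import Function using (_∘_; _⇔_; mk⇔; Equivalence)
  open import Relation.Binary.PropositionalEquality
  open Counting

  -- pow k t denotes t ^ (k + 1).
  pow : ∀ {c} → ℕ → Term c → Term c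
  pow zero    t = t
  pow (suc k) t = t ⊗ pow k t

  ⊤′ : ∀ {d c} → Formula d c
  ⊤′ = zer ≐ zer

  nonzero : ∀ {d c} → Formula d (suc c)
  nonzero = ¬' (var zero ≐ zer)

  ≢-all : ∀ {d c′} → Fin c′ → (c : ℕ) → (Fin c → Fin c′) → Formula d c′
  ≢-all x zero    vars = ⊤′
  ≢-all x (suc c) vars = (¬' (var x ≐ var (vars zero))) ∧' ≢-all x c (vars ∘ suc)

  -- At least j distinct elements satisfy φ, all of them distinct from the c variables in context.
  atLeast : ∀ {d} → (∀ {c} → Formula d (suc c)) → ∀ c → ℕ → Formula d c
  atLeast φ c zero    = ⊤′
  atLeast φ c (suc j) = ∃' ((φ ∧' ≢-all zero c suc) ∧' atLeast φ (suc c) j)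

  -- The language has no constant 1, so x ^ n = 1 is expressed as x ≠ 0 ∧ x ^ (n + 1) = x.
  nthRootOfUnity : ∀ {d c} → ℕ → Formula d (suc c)
  nthRootOfUnity n₀ = nonzero ∧' (pow (suc n₀) (var zero) ≐ var zero)

  nonzeroNthPower : ∀ {d} → ℕ → Formula d 1
  nonzeroNthPower n₀ = nonzero ∧' (∃' (pow n₀ (var zero) ≐ var (suc zero)))

  θ : ∀ {d} → ℕ → Fin d → Sentence d
  θ n₀ r = atLeast (nthRootOfUnity n₀) 0 (suc n₀) ∧' ∃mod r (nonzeroNthPower n₀)

  freshFor : ℕ → (c : ℕ) → (Fin c → ℕ) → Bool
  freshFor z zero    ρ = true
  freshFor z (suc c) ρ = not (z == ρ zero) ∧ freshFor z c (ρ ∘ suc)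

  module _ (m : ℕ) .{{_ : NonZero m}} where

    sat-≢-all : ∀ {d c′} c (vars : Fin c → Fin c′) (ρ : Fin c′ → ℕ) z →
                sat m {d} (≢-all zero c (suc ∘ vars)) (extend ρ z) ≡ freshFor z c (ρ ∘ vars)
    sat-≢-all zero    vars ρ z = refl
    sat-≢-all (suc c) vars ρ z = cong (not (z == ρ (vars zero)) ∧_) (sat-≢-all c (vars ∘ suc) ρ z)

    sat-∃mod : ∀ {d c} (r : Fin d) (ψ : Formula d (suc c)) ρ →
               T (sat m (∃mod r ψ) ρ) ⇔ (countTrue m (λ z → sat m ψ (extend ρ z)) mod d ≡ toℕ r)
    sat-∃mod r ψ ρ = mk⇔ toWitness fromWitness

    mod≡% : ∀ a → a mod m ≡ a % m
    mod≡% a = helper m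
      where
      helper : ∀ k .{{_ : NonZero k}} → a mod k ≡ a % k
      helper (suc k) = refl

    evalT-pow : ∀ {c} k (t : Term c) ρ → evalT m t ρ < m → evalT m (pow k t) ρ ≡ evalT m t ρ ^ suc k % m
    evalT-pow zero    t ρ t<m = sym (trans (cong (_% m) (*-identityʳ _)) (m<n⇒m%n≡m t<m))
    evalT-pow (suc k) t ρ t<m = begin
      (x * evalT m (pow k t) ρ) mod m ≡⟨ mod≡% _ ⟩
      (x * evalT m (pow k t) ρ) % m   ≡⟨ cong (λ y → (x * y) % m) (evalT-pow k t ρ t<m) ⟩
      (x * (x ^ suc k % m)) % m       ≡⟨ %-distribˡ-* x _ m ⟩
      (x % m * (x ^ suc k % m % m)) % m ≡⟨ cong (λ y → (x % m * y) % m) (m%n%n≡m%n _ m) ⟩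
      (x % m * (x ^ suc k % m)) % m   ≡⟨ sym (%-distribˡ-* x (x ^ suc k) m) ⟩
      x ^ suc (suc k) % m             ∎
      where
      open ≡-Reasoning
      x = evalT m t ρ

    module _ {d : ℕ} (φ : ∀ {c} → Formula d (suc c)) (P : ℕ → Bool)
             (sat-φ : ∀ {c} (ρ : Fin c → ℕ) z → z < m → sat m φ (extend ρ z) ≡ P z) where

      candidate? : ∀ c → (Fin c → ℕ) → ℕ → Bool
      candidate? c ρ z = P z ∧ freshFor z c ρ

      sat-step : ∀ c ρ j z → z < m →
                 sat m ((φ ∧' ≢-all zero c suc) ∧' atLeast φ (suc c) j) (extend ρ z)
                 ≡ candidate? c ρ z ∧ sat m (atLeast φ (suc c) j) (extend ρ z)
      sat-step c ρ j z z<m = cong₂ (λ a b → (a ∧ b) ∧ sat m (atLeast φ (suc c) j) (extend ρ z))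
                                   (sat-φ ρ z z<m) (sat-≢-all c (λ i → i) ρ z)

      count-candidate-remove : ∀ c ρ z → z < m → T (candidate? c ρ z) →
                               count m (candidate? c ρ) ≡ suc (count m (candidate? (suc c) (extend ρ z)))
      count-candidate-remove c ρ z z<m cand-z = trans (count-remove m (candidate? c ρ) z z<m cand-z)
        (cong suc (count-cong m (λ w _ → trans (∧-assoc (P w) (freshFor w c ρ) (not (w == z)))
                                                 (cong (P w ∧_) (∧-comm (freshFor w c ρ) (not (w == z)))))))

      sat-atLeast⇒ : ∀ j c ρ → T (sat m (atLeast φ c j) ρ) → j ≤ count m (candidate? c ρ)
      sat-atLeast⇒ zero    c ρ _ = z≤n
      sat-atLeast⇒ (suc j) c ρ t with Equivalence.to (any-upTo⇔ m _) t
      ... | z , z<m , sat-z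
        with Equivalence.to (T-∧ {candidate? c ρ z}) (subst T (sat-step c ρ j z z<m) sat-z)
      ...   | cand-z , rest = subst (suc j ≤_) (sym (count-candidate-remove c ρ z z<m cand-z))
                                    (s≤s (sat-atLeast⇒ j (suc c) (extend ρ z) rest))

      sat-atLeast⇐ : ∀ j c ρ → j ≤ count m (candidate? c ρ) → T (sat m (atLeast φ c j) ρ)
      sat-atLeast⇐ zero    c ρ _        = _
      sat-atLeast⇐ (suc j) c ρ j<count with 0<count⇒∃ m (candidate? c ρ) (<-≤-trans z<s j<count)
      ... | z , z<m , cand-z = Equivalence.from (any-upTo⇔ m _) (z , z<m ,
              subst T (sym (sat-step c ρ j z z<m)) (Equivalence.from (T-∧ {candidate? c ρ z}) (cand-z ,
                sat-atLeast⇐ j (suc c) (extend ρ z)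
                  (≤-pred (subst (suc j ≤_) (count-candidate-remove c ρ z z<m cand-z) j<count)))))

      sat-atLeast : ∀ j → T (sat m (atLeast φ 0 j) noVars) ⇔ (j ≤ count m P)
      sat-atLeast j = mk⇔ (λ t → subst (j ≤_) count-P (sat-atLeast⇒ j 0 noVars t))
                          (λ j≤ → sat-atLeast⇐ j 0 noVars (subst (j ≤_) (sym count-P) j≤))
        where
        count-P : count m (candidate? 0 noVars) ≡ count m P
        count-P = count-cong m (λ z _ → ∧-identityʳ (P z))

module PrimeFieldSemantics {p : ℕ} (prime : Prime p) (n₀ : ℕ) where

  open import Data.Nat using (zero; suc; _≤_; _%_; _^_)
  open import Data.Fin using (Fin; toℕ) renaming (zero to fzero; suc to fsuc)
  open import Data.Bool using (Bool; not; _∧_; T)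
  open import Data.Bool.Properties using (T-∧)
  open import Data.Bool.ListAction using (any)
  open import Data.List using (upTo)
  open import Data.Product using (_×_; _,_)
  open import Function using (_⇔_; mk⇔; Equivalence)
  open import Function.Properties.Equivalence using () renaming (trans to ⇔-trans)
  open import Data.Product.Function.NonDependent.Propositional using (_×-⇔_)
  open import Relation.Binary.PropositionalEquality
  open Counting
  open Sentences
  open ModuloPrime prime using (p≢0)
  open PowerResidues prime (suc n₀)

  sat-nonzeroNthPower : ∀ {d} → ℕ → Bool
  sat-nonzeroNthPower {d} z = sat p {d} (nonzeroNthPower n₀) (extend noVars z)

  sat-atLeast-nthRootOfUnity : ∀ {d} →
    T (sat p {d} (atLeast (nthRootOfUnity n₀) 0 (suc n₀)) noVars) ⇔ (suc n₀ ≤ fibre 1)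
  sat-atLeast-nthRootOfUnity {d} = mk⇔
    (λ t → subst (suc n₀ ≤_) count-fixed≡fibre₁ (Equivalence.to (sat-atLeast-fixed) t))
    (λ n≤ → Equivalence.from sat-atLeast-fixed (subst (suc n₀ ≤_) (sym count-fixed≡fibre₁) n≤))
    where
    fixed? : ℕ → Bool
    fixed? z = not (z == 0) ∧ z ^ suc (suc n₀) % p == z
    sat-fixed : ∀ {c} (ρ : Fin c → ℕ) z → z < p → sat p {d} (nthRootOfUnity n₀) (extend ρ z) ≡ fixed? z
    sat-fixed ρ z z<p =
      cong (λ v → not (z == 0) ∧ v == z) (evalT-pow p (suc n₀) (var fzero) (extend ρ z) z<p)
    sat-atLeast-fixed = sat-atLeast p (nthRootOfUnity n₀) fixed? sat-fixed (suc n₀)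
    count-fixed≡fibre₁ : count p fixed? ≡ fibre 1
    count-fixed≡fibre₁ = count-cong p nonzero-fixed≡nthRootOfUnity

  count-sat-nonzeroNthPower : ∀ {d} → countTrue p (sat-nonzeroNthPower {d}) ≡ count p nonzeroNthPower?
  count-sat-nonzeroNthPower {d} = trans (countTrue≡count p (sat-nonzeroNthPower {d}))
    (count-cong p (λ z z<p → cong (not (z == 0) ∧_)
      (T-ext (transport (sat-root z)) (transport (λ x x<p → sym (sat-root z x x<p))))))
    where
    sat-root : ∀ z x → x < p →
               sat p {d} (pow n₀ (var fzero) ≐ var (fsuc fzero)) (extend (extend noVars z) x) ≡ nthRoot? z x
    sat-root z x x<p = cong (_== z) (evalT-pow p n₀ (var fzero) (extend (extend noVars z) x) x<p)
    transport : ∀ {f g : ℕ → Bool} → (∀ x → x < p → g x ≡ f x) → T (any g (upTo p)) → T (any f (upTo p))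
    transport {f} {g} g≡f t with Equivalence.to (any-upTo⇔ p g) t
    ... | x , x<p , gx = Equivalence.from (any-upTo⇔ p f) (x , x<p , subst T (g≡f x x<p) gx)

  sat-θ : ∀ {d} (r : Fin d) → (p ⊨ θ n₀ r) ⇔ (suc n₀ ≤ fibre 1 × count p nonzeroNthPower? mod d ≡ toℕ r)
  sat-θ {d} r = ⇔-trans (T-∧ {sat p (atLeast (nthRootOfUnity n₀) 0 (suc n₀)) noVars})
    (sat-atLeast-nthRootOfUnity ×-⇔ ⇔-trans (sat-∃mod p r (nonzeroNthPower n₀) noVars) count-mod≡r)
    where
    count-mod≡r : (countTrue p (sat-nonzeroNthPower {d}) mod d ≡ toℕ r)
                  ⇔ (count p nonzeroNthPower? mod d ≡ toℕ r)
    count-mod≡r = mk⇔ (subst (λ c → c mod d ≡ toℕ r) (count-sat-nonzeroNthPower {d}))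
                      (subst (λ c → c mod d ≡ toℕ r) (sym (count-sat-nonzeroNthPower {d})))

module ResidueCondition where

  open import Data.Nat as ℕ using (ℕ; suc; NonZero)
  import Data.Nat.Divisibility as ℕ
  open import Data.Integer using (+_; _+_; _-_; _*_; ∣_∣)
  open import Data.Integer.Properties using (pos-+; pos-*)
  import Data.Integer.Divisibility as Unsigned
  open import Data.Integer.Divisibility.Signed
  open import Data.Integer.Tactic.RingSolver using (solve-∀)
  open import Function using (_⇔_; mk⇔)
  open import Relation.Binary.PropositionalEquality
  open Congruence

  +[1+q]-+[a+1]≡+q-+a : ∀ q a → + suc q - + (a ℕ.+ 1) ≡ + q - + a
  +[1+q]-+[a+1]≡+q-+a q a = trans (cong₂ _-_ (pos-+ 1 q) (pos-+ a 1)) (lemma (+ q) (+ a))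
    where
    lemma : ∀ x y → + 1 + x - (y + + 1) ≡ x - y
    lemma = solve-∀

  InResidueClass : ℕ → ℕ → ℕ → ℕ → Set
  InResidueClass n d r p = + (n ℕ.* d) Unsigned.∣ + p - + (r ℕ.* n ℕ.+ 1)

  inResidueClass⇒∣ : ∀ n d r q → InResidueClass n d r (suc q) → n ℕ.∣ q
  inResidueClass⇒∣ n d r q nd∣ = ∣⇒∣ᵤ (∣-≡ (lemma (+ q) (+ r) (+ n)) (∣m∣n⇒∣m+n n∣q-rn n∣rn))
    where
    n∣q-rn : + n ∣ + q - + r * + n
    n∣q-rn = ∣ᵤ⇒∣ (ℕ.∣-trans (ℕ.m∣m*n d) (subst (λ x → n ℕ.* d ℕ.∣ ∣ x ∣) eq nd∣))
      where
      eq : + suc q - + (r ℕ.* n ℕ.+ 1) ≡ + q - + r * + n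
      eq = trans (+[1+q]-+[a+1]≡+q-+a q (r ℕ.* n)) (cong (+ q -_) (pos-* r n))
    n∣rn : + n ∣ + r * + n
    n∣rn = ∣n⇒∣m*n (+ r) ∣-refl
    lemma : ∀ q r n → q - r * n + r * n ≡ q
    lemma = solve-∀

  inResidueClass⇔≡mod : ∀ n .{{_ : NonZero n}} d r m →
                        InResidueClass n d r (suc (n ℕ.* m)) ⇔ (+ m ≡ + r [mod d ])
  inResidueClass⇔≡mod n d r m = mk⇔
    (λ nd∣ → ≡mod (*-cancelˡ-∣ (+ n) (subst₂ _∣_ (pos-* n d) eq (∣ᵤ⇒∣ nd∣))))
    (λ { (≡mod d∣m-r) → ∣⇒∣ᵤ (subst₂ _∣_ (sym (pos-* n d)) (sym eq) (*-monoʳ-∣ (+ n) d∣m-r)) })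
    where
    lemma : ∀ n m r → n * m - r * n ≡ n * (m - r)
    lemma = solve-∀
    eq : + suc (n ℕ.* m) - + (r ℕ.* n ℕ.+ 1) ≡ + n * (+ m - + r)
    eq = trans (+[1+q]-+[a+1]≡+q-+a (n ℕ.* m) (r ℕ.* n))
               (trans (cong₂ _-_ (pos-* n m) (pos-* r n)) (lemma (+ n) (+ m) (+ r)))

module Spectrum {p : ℕ} (prime : Prime p) (n₀ d₀ r : ℕ) (r<d : r < suc d₀) where

  open import Data.Nat as ℕ using (suc; _∸_; _%_)
  import Data.Nat.Properties as ℕ
  open import Data.Nat.Divisibility using (_∣?_; divides)
  open import Data.Integer using (+_)
  open import Data.Fin using (fromℕ<; toℕ)
  open import Data.Fin.Properties using (toℕ-fromℕ<)
  open import Data.Product using (_×_; _,_; proj₁)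
  open import Data.Empty using (⊥-elim)
  open import Function using (_⇔_; mk⇔; Equivalence)
  open import Function.Properties.Equivalence using () renaming (trans to ⇔-trans; sym to ⇔-sym)
  open import Relation.Nullary using (yes; no)
  open import Relation.Binary.PropositionalEquality
  open Counting using (count)
  open Congruence
  open Sentences using (θ)
  open ModuloPrime prime using (p≡1+[p∸1])
  open PowerResidues prime (suc n₀)
  open PrimeFieldSemantics prime n₀
  open ResidueCondition

  n = suc n₀
  d = suc d₀

  ⊨θ⇔inResidueClass : (p ⊨ θ n₀ (fromℕ< r<d)) ⇔ InResidueClass n d r p
  ⊨θ⇔inResidueClass with n ∣? p ∸ 1
  ... | no n∤p∸1 = mk⇔
    (λ ⊨θ → ⊥-elim (n∤p∸1 (fibre₁≥n⇒n∣p∸1 (proj₁ (Equivalence.to (sat-θ (fromℕ< r<d)) ⊨θ)))))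
    (λ p∈ → ⊥-elim (n∤p∸1 (inResidueClass⇒∣ n d r (p ∸ 1) (subst (InResidueClass n d r) p≡1+[p∸1] p∈))))
  ... | yes (divides m p∸1≡m*n) =
    ⇔-trans (sat-θ (fromℕ< r<d)) (⇔-trans count%d≡r⇔m%d≡r (⇔-trans m%d≡r⇔≡mod (⇔-sym p∈⇔≡mod)))
    where
    p∸1≡n*m : p ∸ 1 ≡ n ℕ.* m
    p∸1≡n*m = trans p∸1≡m*n (ℕ.*-comm m n)
    count≡m : count p nonzeroNthPower? ≡ m
    count≡m = count-nonzeroNthPower≡m p∸1≡n*m
    count%d≡r⇔m%d≡r : (n ℕ.≤ fibre 1 × count p nonzeroNthPower? % d ≡ toℕ (fromℕ< r<d)) ⇔ (m % d ≡ r)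
    count%d≡r⇔m%d≡r = mk⇔
      (λ (_ , count%d≡r) → trans (cong (_% d) (sym count≡m)) (trans count%d≡r (toℕ-fromℕ< r<d)))
      (λ m%d≡r → ℕ.≤-reflexive (sym (fibre₁≡n p∸1≡n*m)) ,
                 trans (cong (_% d) count≡m) (trans m%d≡r (sym (toℕ-fromℕ< r<d))))
    m%d≡r⇔≡mod : (m % d ≡ r) ⇔ (+ m ≡ + r [mod d ])
    m%d≡r⇔≡mod = mk⇔ (%≡⇒≡mod-< r<d) (≡mod⇒%≡-< r<d)
    p∈⇔≡mod : InResidueClass n d r p ⇔ (+ m ≡ + r [mod d ])
    p∈⇔≡mod = subst (λ x → InResidueClass n d r x ⇔ (+ m ≡ + r [mod d ]))
                    (sym (trans p≡1+[p∸1] (cong suc p∸1≡n*m))) (inResidueClass⇔≡mod n d r m)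

open Sentences using (θ)
open Spectrum using (⊨θ⇔inResidueClass)

theorem5p11 : ∀ (n d : ℕ) → 1 < n → 1 < d → ∀ (r : ℕ) → r < d →
    ∃[ θ ] (Sp {d} θ =* PrimesCong n d r)
theorem5p11 (suc n₀) (suc d₀) _ _ r r<d = θ n₀ (fromℕ< r<d) , 0 , λ p _ →
  (λ (p-prime , ⊨θ) → p-prime , Equivalence.to (⊨θ⇔inResidueClass p-prime n₀ d₀ r r<d) ⊨θ) ,
  (λ (p-prime , p∈) → p-prime , Equivalence.from (⊨θ⇔inResidueClass p-prime n₀ d₀ r r<d) p∈)
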